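{- Let $D=(v_0,\dots,v_n)$ be an FDAG with $n+1$ vertices, and let $\pi_D:\{0,\dots,n\}\to\mathbb{N}$ be its presence vector ($\pi_D(i)=1$ if $v_i$ has no parent, $0$ otherwise). Consider the enumeration tree whose nodes are pairs $(\pi,j)$ with root $(\pi_D,0)$ and where the successors of $(\pi,j)$ are the pairs $(\pi+e_{j'},j')$ for $j'\in\{j,\dots,n\}$ ($e_{j'}$ the indicator of $j'$). Then, for every $k\ge1$, the number of nodes of this tree at depth between $1$ and $k$ (that is, the number of forests with repetitions constructible in at most $k$ steps from the irredundant forest compressed by $D$) equals $\binom{n+1+k}{k}-1$.
   Context: An FDAG is the DAG reduction of an irredundant forest (a finite set of finite unordered rooted trees, none isomorphic to a subtree of another): one vertex per isomorphism class of subtrees, with arcs (with multiplicity) from each class to the classes of the children of a representative. Its vertices are numbered $v_0,\dots,v_n$ by its canonical topological ordering. A forest with repetitions $F$ is encoded by the pair $(D,\pi)$ where $D$ is the DAG reduction of $F$ and $\pi(i)$ counts how many trees of $F$ are isomorphic to the tree compressed by the subgraph of $D$ rooted at $v_i$; incrementing $\pi(j')$ by one adds one more copy of that tree. -}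

module Defs where

open import Data.Nat using (ℕ; zero; suc; _+_)
open import Data.Fin using (Fin; _<_; _≤?_; _≟_)
open import Data.Fin.Properties using (all?)
open import Data.List using (List; []; _∷_; filter; concatMap; length; allFin)
open import Data.Product using (_×_; _,_)
open import Relation.Nullary using (¬_; yes; no)
open import Relation.Binary.PropositionalEquality using (_≡_)

-- A DAG on vertices v_0,…,v_n (numbered by a topological ordering):
-- arcs i j = multiplicity of the arc v_i → v_j (v_j a child of v_i).
record DAG (n : ℕ) : Set where
  field
    arcs        : Fin (suc n) → Fin (suc n) → ℕ
    topological : ∀ i j → ¬ (arcs i j ≡ 0) → i < j

presence : ∀ {n} → DAG n → Fin (suc n) → ℕ
presence D i with all? (λ p → DAG.arcs D p i Data.Nat.≟ 0)
... | yes _ = 1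
... | no  _ = 0

e : ∀ {n} → Fin (suc n) → Fin (suc n) → ℕ
e j i with i ≟ j
... | yes _ = 1
... | no  _ = 0

Node : ℕ → Set
Node n = (Fin (suc n) → ℕ) × Fin (suc n)

successors : ∀ {n} → Node n → List (Node n)
successors {n} (π , j) =
  Data.List.map (λ j' → ((λ i → π i + e j' i) , j'))
                (filter (λ j' → j ≤? j') (allFin (suc n)))

level : ∀ {n} → DAG n → ℕ → List (Node n)
level D zero    = (presence D , Fin.zero) ∷ []
level D (suc d) = concatMap successors (level D d)

nodesUpTo : ∀ {n} → DAG n → ℕ → ℕ
nodesUpTo D zero    = 0
nodesUpTo D (suc k) = nodesUpTo D k + length (level D (suc k))

-- A node (π , j) has one successor for each index j' ∈ {j, …, n}, so its descendants at depth d
-- correspond to the multisets of size d drawn from n ∸ j + 1 indices: there are C(n ∸ j + d, d)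
-- of them, by induction on d and the hockey-stick identity. The root has j = 0, and summing
-- C(n + d, d) over 0 ≤ d ≤ k gives C(n + 1 + k, k) by parallel summation; the d = 0 term is
-- the root itself, whence the − 1.
module Submission where

open import Defs
open import Data.Nat using (ℕ; _+_; _∸_; _≥_)
open import Data.Nat.Combinatorics using (_C_)
open import Relation.Binary.PropositionalEquality using (_≡_)

open import Data.Nat using (zero; suc; z≤n; s≤s; s≤s⁻¹)
open import Data.Nat.Properties using (+-comm; +-suc; +-identityʳ)
open import Data.Nat.Combinatorics using (nCn≡1; nCk+nC[k+1]≡[n+1]C[k+1])
open import Data.Nat.ListAction using (sum)
open import Data.Fin using (Fin; toℕ; _≤?_) renaming (zero to fzero; suc to fsuc)
open import Data.List using (List; []; _∷_; [_]; map; filter; concatMap; length; allFin)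
open import Data.List.Properties using (length-++; map-∘; map-cong; map-tabulate; concatMap-cong; filter-≐)
open import Data.List.Effectful using (module MonadProperties)
open import Data.Product using (proj₂; _,_)
open import Relation.Nullary using (yes; no)
open import Relation.Unary using (Pred; Decidable)
open import Relation.Binary.PropositionalEquality using (refl; sym; trans; cong; cong₂; module ≡-Reasoning)
open import Function using (_∘_; id)
open import Level using (Level)

private
  variable
    a p : Level
    A B : Set a

Σ≤ : ℕ → (ℕ → ℕ) → ℕ
Σ≤ zero    f = f 0
Σ≤ (suc m) f = Σ≤ m f + f (suc m)

syntax Σ≤ m (λ t → e) = ∑[ t ≤ m ] e

hockey-stick : ∀ d m → ∑[ t ≤ m ] ((t + d) C d) ≡ (m + suc d) C suc d
hockey-stick d zero    = trans (nCn≡1 d) (sym (nCn≡1 (suc d)))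
hockey-stick d (suc m) = begin
  ∑[ t ≤ m ] ((t + d) C d) + (suc m + d) C d     ≡⟨ cong (_+ (suc m + d) C d) (hockey-stick d m) ⟩
  (m + suc d) C suc d + (suc m + d) C d          ≡⟨ cong (λ x → x C suc d + (suc m + d) C d) (+-suc m d) ⟩
  (suc m + d) C suc d + (suc m + d) C d          ≡⟨ +-comm ((suc m + d) C suc d) _ ⟩
  (suc m + d) C d + (suc m + d) C suc d          ≡⟨ nCk+nC[k+1]≡[n+1]C[k+1] (suc m + d) d ⟩
  suc (suc m + d) C suc d                        ≡⟨ cong (_C suc d) (+-suc (suc m) d) ⟨
  (suc m + suc d) C suc d                        ∎
  where open ≡-Reasoning

parallel-summation : ∀ m k → ∑[ d ≤ k ] ((m + d) C d) ≡ (suc m + k) C k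
parallel-summation m zero    = refl
parallel-summation m (suc k) = begin
  ∑[ d ≤ k ] ((m + d) C d) + (m + suc k) C suc k    ≡⟨ cong₂ _+_ (parallel-summation m k) (cong (_C suc k) (+-suc m k)) ⟩
  (suc m + k) C k + (suc m + k) C suc k             ≡⟨ nCk+nC[k+1]≡[n+1]C[k+1] (suc m + k) k ⟩
  suc (suc m + k) C suc k                           ≡⟨ cong (_C suc k) (+-suc (suc m) k) ⟨
  (suc m + suc k) C suc k                           ∎
  where open ≡-Reasoning

length-concatMap : (f : A → List B) (xs : List A) →
                   length (concatMap f xs) ≡ sum (map (length ∘ f) xs)
length-concatMap f []       = refl
length-concatMap f (x ∷ xs) =
  trans (length-++ (f x)) (cong (length (f x) +_) (length-concatMap f xs))

filter-map : {P : Pred B p} (P? : Decidable P) (f : A → B) (xs : List A) →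
             filter P? (map f xs) ≡ map f (filter (P? ∘ f) xs)
filter-map P? f []       = refl
filter-map P? f (x ∷ xs) with P? (f x)
... | yes _ = cong (f x ∷_) (filter-map P? f xs)
... | no  _ = filter-map P? f xs

allFin-suc : ∀ n → allFin (suc n) ≡ fzero ∷ map fsuc (allFin n)
allFin-suc n = cong (fzero ∷_) (sym (map-tabulate id fsuc))

indicesFrom : ∀ {n} → Fin n → List (Fin n)
indicesFrom {n} j = filter (j ≤?_) (allFin n)

indicesFrom-fzero : ∀ n → indicesFrom (fzero {suc n}) ≡ fzero ∷ map fsuc (indicesFrom (fzero {n}))
indicesFrom-fzero n = begin
  filter (fzero {suc n} ≤?_) (allFin (suc (suc n)))
    ≡⟨ cong (filter (fzero {suc n} ≤?_)) (allFin-suc (suc n)) ⟩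
  fzero ∷ filter (fzero {suc n} ≤?_) (map fsuc (allFin (suc n)))
    ≡⟨ cong (fzero ∷_) (filter-map (fzero {suc n} ≤?_) fsuc (allFin (suc n))) ⟩
  fzero ∷ map fsuc (filter (λ j' → fzero {suc n} ≤? fsuc j') (allFin (suc n)))
    ≡⟨ cong (λ js → fzero ∷ map fsuc js) (filter-≐ (λ j' → fzero {suc n} ≤? fsuc j') (fzero {n} ≤?_) ((λ _ → z≤n) , (λ _ → z≤n)) (allFin (suc n))) ⟩
  fzero ∷ map fsuc (filter (fzero {n} ≤?_) (allFin (suc n)))
    ∎
  where open ≡-Reasoning

indicesFrom-fsuc : ∀ {n} (j : Fin n) → indicesFrom (fsuc j) ≡ map fsuc (indicesFrom j)
indicesFrom-fsuc {n} j = begin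
  filter (fsuc j ≤?_) (allFin (suc n))                        ≡⟨ cong (filter (fsuc j ≤?_)) (allFin-suc n) ⟩
  filter (fsuc j ≤?_) (map fsuc (allFin n))                   ≡⟨ filter-map (fsuc j ≤?_) fsuc (allFin n) ⟩
  map fsuc (filter (λ j' → fsuc j ≤? fsuc j') (allFin n))     ≡⟨ cong (map fsuc) (filter-≐ _ (j ≤?_) (s≤s⁻¹ , s≤s) (allFin n)) ⟩
  map fsuc (filter (j ≤?_) (allFin n))                        ∎
  where open ≡-Reasoning

sum-indicesFrom : ∀ n (j : Fin (suc n)) (h : ℕ → ℕ) →
                  sum (map (λ j' → h (n ∸ toℕ j')) (indicesFrom j)) ≡ ∑[ t ≤ n ∸ toℕ j ] h t
sum-indicesFrom zero    fzero    h = +-identityʳ (h 0)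
sum-indicesFrom (suc n) fzero    h = begin
  sum (map g (indicesFrom fzero))
    ≡⟨ cong (sum ∘ map g) (indicesFrom-fzero n) ⟩
  h (suc n) + sum (map g (map fsuc (indicesFrom (fzero {n}))))
    ≡⟨ cong (λ js → h (suc n) + sum js) (map-∘ {g = g} {f = fsuc} (indicesFrom fzero)) ⟨
  h (suc n) + sum (map (λ j' → h (n ∸ toℕ j')) (indicesFrom (fzero {n})))
    ≡⟨ cong (h (suc n) +_) (sum-indicesFrom n fzero h) ⟩
  h (suc n) + ∑[ t ≤ n ] h t
    ≡⟨ +-comm (h (suc n)) _ ⟩
  ∑[ t ≤ suc n ] h t
    ∎
  where
    open ≡-Reasoning
    g : Fin (suc (suc n)) → ℕ
    g j' = h (suc n ∸ toℕ j')
sum-indicesFrom (suc n) (fsuc j) h = begin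
  sum (map g (indicesFrom (fsuc j)))                      ≡⟨ cong (sum ∘ map g) (indicesFrom-fsuc j) ⟩
  sum (map g (map fsuc (indicesFrom j)))                  ≡⟨ cong sum (map-∘ {g = g} {f = fsuc} (indicesFrom j)) ⟨
  sum (map (λ j' → h (n ∸ toℕ j')) (indicesFrom j))       ≡⟨ sum-indicesFrom n j h ⟩
  ∑[ t ≤ n ∸ toℕ j ] h t                                  ∎
  where
    open ≡-Reasoning
    g : Fin (suc (suc n)) → ℕ
    g j' = h (suc n ∸ toℕ j')

module _ {n : ℕ} where

  descendants : ℕ → Node n → List (Node n)
  descendants zero    x = [ x ]
  descendants (suc d) x = concatMap (descendants d) (successors x)

  descendants-suc : ∀ d (x : Node n) →
                    concatMap successors (descendants d x) ≡ descendants (suc d) x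
  descendants-suc zero    x = trans (MonadProperties.left-identity x successors)
                                    (sym (MonadProperties.right-identity (successors x)))
  descendants-suc (suc d) x = begin
    concatMap successors (concatMap (descendants d) (successors x))
      ≡⟨ MonadProperties.associative (successors x) (descendants d) successors ⟨
    concatMap (concatMap successors ∘ descendants d) (successors x)
      ≡⟨ concatMap-cong (descendants-suc d) (successors x) ⟩
    concatMap (descendants (suc d)) (successors x) ∎
    where open ≡-Reasoning

  level≡descendants : (D : DAG n) (d : ℕ) → level D d ≡ descendants d (presence D , fzero)
  level≡descendants D zero    = refl
  level≡descendants D (suc d) =
    trans (cong (concatMap successors) (level≡descendants D d)) (descendants-suc d _)

  length-descendants : ∀ d (x : Node n) →
                       length (descendants d x) ≡ (n ∸ toℕ (proj₂ x) + d) C d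
  length-descendants zero    x       = refl
  length-descendants (suc d) (π , j) = begin
    length (concatMap (descendants d) (successors (π , j)))
      ≡⟨ length-concatMap (descendants d) (successors (π , j)) ⟩
    sum (map (length ∘ descendants d) (map (λ j' → (_ , j')) js))
      ≡⟨ cong sum (map-∘ js) ⟨
    sum (map (λ j' → length (descendants d (_ , j'))) js)
      ≡⟨ cong sum (map-cong (λ j' → length-descendants d (_ , j')) js) ⟩
    sum (map (λ j' → (n ∸ toℕ j' + d) C d) js)
      ≡⟨ sum-indicesFrom n j (λ t → (t + d) C d) ⟩
    ∑[ t ≤ n ∸ toℕ j ] ((t + d) C d)
      ≡⟨ hockey-stick d (n ∸ toℕ j) ⟩
    (n ∸ toℕ j + suc d) C suc d ∎
    where
      open ≡-Reasoning
      js : List (Fin (suc n))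
      js = indicesFrom j

length-level : ∀ {n} (D : DAG n) d → length (level D d) ≡ (n + d) C d
length-level D d = trans (cong length (level≡descendants D d)) (length-descendants d _)

suc-nodesUpTo : ∀ {n} (D : DAG n) k → suc (nodesUpTo D k) ≡ ∑[ d ≤ k ] ((n + d) C d)
suc-nodesUpTo D zero    = refl
suc-nodesUpTo D (suc k) = cong₂ _+_ (suc-nodesUpTo D k) (length-level D (suc k))

proposition4p2 : (n : ℕ) (D : DAG n) (k : ℕ) → k ≥ 1 →
                 nodesUpTo D k ≡ ((n + 1 + k) C k) ∸ 1
proposition4p2 n D k _ = begin
  nodesUpTo D k                    ≡⟨⟩
  suc (nodesUpTo D k) ∸ 1          ≡⟨ cong (_∸ 1) (suc-nodesUpTo D k) ⟩
  ∑[ d ≤ k ] ((n + d) C d) ∸ 1     ≡⟨ cong (_∸ 1) (parallel-summation n k) ⟩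
  (1 + n + k) C k ∸ 1              ≡⟨ cong (λ m → (m + k) C k ∸ 1) (+-comm 1 n) ⟩
  (n + 1 + k) C k ∸ 1              ∎
  where open ≡-Reasoning
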